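{- Let $p \ge 5$ and $p \le q \le 2p$. Then $f(K(3,p,q)) = 2$.
   Context: $K(3,p,q)$ is the complete tripartite graph with parts of sizes $3$, $p$, $q$. A strong orientation of a graph is an orientation of all edges making the digraph strongly connected; the diameter of a strongly connected digraph is the maximum directed distance between ordered pairs of vertices. The oriented diameter $f(G)$ is the minimum diameter over all strong orientations of $G$. -}

module Defs where

open import Data.Nat using (ℕ; zero; suc; _≤_; _<_)
open import Data.Fin using (Fin; zero; suc)
open import Data.Product using (Σ; ∃; ∃-syntax; _×_; _,_)
open import Data.Sum using (_⊎_)
open import Relation.Nullary using (¬_)
open import Relation.Binary.PropositionalEquality using (_≢_)

record Graph : Set₁ where
  field
    V   : Set
    Adj : V → V → Set

open Graph public

Digraph : Set → Set₁
Digraph V = V → V → Set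

record IsOrientation (G : Graph) (O : Digraph (V G)) : Set where
  field
    arc⇒adj : ∀ u v → O u v → Adj G u v
    adj⇒arc : ∀ u v → Adj G u v → O u v ⊎ O v u
    antisym : ∀ u v → O u v → ¬ O v u

data Walk {V : Set} (O : Digraph V) : ℕ → V → V → Set where
  nil  : ∀ {u} → Walk O zero u u
  cons : ∀ {n u w v} → O u w → Walk O n w v → Walk O (suc n) u v

Within : {V : Set} → Digraph V → ℕ → V → V → Set
Within O k u v = ∃[ n ] (n ≤ k × Walk O n u v)

StronglyConnected : {V : Set} → Digraph V → Set
StronglyConnected O = ∀ u v → ∃[ n ] Walk O n u v

IsDiameter : {V : Set} → Digraph V → ℕ → Set
IsDiameter O d =
  (∀ u v → Within O d u v) × (∀ d' → d' < d → ∃[ u ] ∃[ v ] ¬ Within O d' u v)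

OrientedDiameter : Graph → ℕ → Set₁
OrientedDiameter G d =
  (∃[ O ] (IsOrientation G O × StronglyConnected O × IsDiameter O d)) ×
  (∀ (O : Digraph (V G)) → IsOrientation G O → StronglyConnected O →
     ∀ d' → IsDiameter O d' → d ≤ d')

-- complete tripartite graph K(a,b,c): vertices (i , x) with part i ∈ Fin 3,
-- x ∈ Fin (size of part i); adjacent iff in different parts.
partSize : ℕ → ℕ → ℕ → Fin 3 → ℕ
partSize a b c zero = a
partSize a b c (suc zero) = b
partSize a b c (suc (suc zero)) = c

K3 : ℕ → ℕ → ℕ → Graph
K3 a b c = record
  { V   = Σ (Fin 3) (λ i → Fin (partSize a b c i))
  ; Adj = λ { (i , _) (j , _) → i ≢ j } }

{-# OPTIONS --safe #-}
-- Two vertices of the part of size 3 are nonadjacent, so every orientation has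
-- diameter at least 2. For an orientation of diameter 2 write the parts as
-- {a₀, a₁, a₂}, {b_i | i < p} and C ∪ D with C = {c_i | i < p} and
-- D = {d_j | j < q − p}; since q ≤ 2p, both c_i and d_i have the twin b_i.
-- Orient b → c except that each c_i points to its twin, d → b except that each
-- d_j is entered from its twin, a₀ → B and C ∪ D → a₀; a₁ points to b₀, b₁ and
-- to the remaining c's, a₂ to the remaining b's and to c₀, c₁, and both point
-- to all of D. Every ordered pair is then joined by a path of length at most 2,
-- mostly through a twin; otherwise the middle vertex is picked among two or
-- three candidates so as to avoid one or two forbidden twins, which p ≥ 4 allows.
module Submission where

open import Defs
open import Data.Nat using (ℕ; _≤_; _*_)
open import Data.Nat as ℕ using (suc; _+_; _<_; z≤n; s≤s)
import Data.Nat.Properties as ℕ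
open import Data.Bool using (Bool; true; false; not; T)
open import Data.Bool.Properties using (not-involutive)
open import Data.Unit using (tt)
open import Data.Empty using (⊥-elim)
open import Data.Fin using (Fin; suc; _↑ˡ_; _↑ʳ_; splitAt; inject≤)
open import Data.Fin.Patterns using (0F; 1F; 2F; 3F)
open import Data.Fin.Properties
  using (_≟_; splitAt-↑ˡ; splitAt-↑ʳ; splitAt⁻¹-↑ˡ; splitAt⁻¹-↑ʳ; inject≤-injective)
open import Data.Product using (∃-syntax; _×_; _,_)
open import Data.Sum using (_⊎_; inj₁; inj₂; [_,_]′)
import Data.Sum as Sum
open import Function using (_∘_; const)
open import Relation.Nullary using (¬_; yes; no; does)
open import Relation.Nullary.Decidable using (dec-true; dec-false)
open import Relation.Binary.PropositionalEquality
  using (_≡_; _≢_; refl; sym; subst; ≢-sym)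

module _ {X : Set} {O : Digraph X} where

  Within-weaken : ∀ {k l u v} → k ≤ l → Within O k u v → Within O l u v
  Within-weaken k≤l (n , n≤k , w) = n , ℕ.≤-trans n≤k k≤l , w

  Within-all⇒StronglyConnected : ∀ {k} → (∀ u v → Within O k u v) →
                                 StronglyConnected O
  Within-all⇒StronglyConnected within u v with within u v
  ... | n , _ , w = n , w

module _ {G : Graph} {O : Digraph (V G)} where

  nonadjacent⇒¬Within1 : IsOrientation G O → ∀ {u v} → u ≢ v → ¬ Adj G u v →
                          ¬ Within O 1 u v
  nonadjacent⇒¬Within1 _   u≢v _    (0 , _ , nil)        = u≢v refl
  nonadjacent⇒¬Within1 ori _   ¬adj (1 , _ , cons e nil) =
    ¬adj (IsOrientation.arc⇒adj ori _ _ e)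
  nonadjacent⇒¬Within1 _   _   _    (suc (suc _) , s≤s () , _)

  diameter≥2 : IsOrientation G O → ∀ {u v} → u ≢ v → ¬ Adj G u v →
               ∀ {d} → IsDiameter O d → 2 ≤ d
  diameter≥2 ori u≢v ¬adj (within , _) = ℕ.≮⇒≥ λ d<2 →
    nonadjacent⇒¬Within1 ori u≢v ¬adj (Within-weaken (ℕ.s≤s⁻¹ d<2) (within _ _))

orientedDiameter≡2 : ∀ {G : Graph} {u v : V G} → u ≢ v → ¬ Adj G u v →
                     ∀ {O} → IsOrientation G O → (∀ x y → Within O 2 x y) →
                     OrientedDiameter G 2
orientedDiameter≡2 {u = u} {v} u≢v ¬adj {O} ori within =
  (O , ori , Within-all⇒StronglyConnected {O = O} within , within , below2) ,
  λ _ ori′ _ _ → diameter≥2 ori′ u≢v ¬adj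
  where
  below2 : ∀ d → d < 2 → ∃[ x ] ∃[ y ] ¬ Within O d x y
  below2 d d<2 =
    u , v , nonadjacent⇒¬Within1 ori u≢v ¬adj ∘ Within-weaken {O = O} (ℕ.s≤s⁻¹ d<2)

T⊎T-not : ∀ x → T x ⊎ T (not x)
T⊎T-not true  = inj₁ tt
T⊎T-not false = inj₂ tt

T-not⇒¬T : ∀ {x} → T (not x) → ¬ T x
T-not⇒¬T {false} _ ()

module Tripartite {a b c : ℕ}
  (ab : Fin a → Fin b → Bool) (ac : Fin a → Fin c → Bool) (bc : Fin b → Fin c → Bool)
  where

  Vertex : Set
  Vertex = V (K3 a b c)

  arc : Vertex → Vertex → Bool
  arc (0F , x) (1F , y) = ab x y
  arc (1F , y) (0F , x) = not (ab x y)
  arc (0F , x) (2F , z) = ac x z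
  arc (2F , z) (0F , x) = not (ac x z)
  arc (1F , y) (2F , z) = bc y z
  arc (2F , z) (1F , y) = not (bc y z)
  arc (0F , _) (0F , _) = false
  arc (1F , _) (1F , _) = false
  arc (2F , _) (2F , _) = false

  Arc : Digraph Vertex
  Arc u v = T (arc u v)

  arc-flip : ∀ u v → Adj (K3 a b c) u v → arc v u ≡ not (arc u v)
  arc-flip (0F , _) (1F , _) _ = refl
  arc-flip (1F , _) (0F , _) _ = sym (not-involutive _)
  arc-flip (0F , _) (2F , _) _ = refl
  arc-flip (2F , _) (0F , _) _ = sym (not-involutive _)
  arc-flip (1F , _) (2F , _) _ = refl
  arc-flip (2F , _) (1F , _) _ = sym (not-involutive _)
  arc-flip (0F , _) (0F , _) i≢i = ⊥-elim (i≢i refl)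
  arc-flip (1F , _) (1F , _) i≢i = ⊥-elim (i≢i refl)
  arc-flip (2F , _) (2F , _) i≢i = ⊥-elim (i≢i refl)

  ¬Arc-within-part : ∀ i {x y} → ¬ Arc (i , x) (i , y)
  ¬Arc-within-part 0F ()
  ¬Arc-within-part 1F ()
  ¬Arc-within-part 2F ()

  arc⇒adj : ∀ u v → Arc u v → Adj (K3 a b c) u v
  arc⇒adj (i , _) (.i , _) e refl = ¬Arc-within-part i e

  isOrientation : IsOrientation (K3 a b c) Arc
  isOrientation = record
    { arc⇒adj = arc⇒adj
    ; adj⇒arc = λ u v adj →
        Sum.map₂ (subst T (sym (arc-flip u v adj))) (T⊎T-not (arc u v))
    ; antisym = λ u v e e′ →
        T-not⇒¬T (subst T (arc-flip u v (arc⇒adj u v e)) e′) e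
    }

avoiding : ∀ {n} {P : Fin n → Set} {x y : Fin n} → x ≢ y → P x → P y →
           ∀ t → ∃[ z ] (P z × z ≢ t)
avoiding {x = x} {y} x≢y px py t with x ≟ t
... | no x≢t   = x , px , x≢t
... | yes refl = y , py , ≢-sym x≢y

avoiding₂ : ∀ {n} (s t : Fin (3 + n)) → ∃[ z ] (z ≢ s × z ≢ t)
avoiding₂ 0F            0F            = 1F , (λ ()) , (λ ())
avoiding₂ 0F            1F            = 2F , (λ ()) , (λ ())
avoiding₂ 0F            (suc (suc _)) = 1F , (λ ()) , (λ ())
avoiding₂ 1F            0F            = 2F , (λ ()) , (λ ())
avoiding₂ (suc (suc _)) 0F            = 1F , (λ ()) , (λ ())
avoiding₂ (suc _)       (suc _)       = 0F , (λ ()) , (λ ())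

small : ∀ {n} → Fin n → Bool
small 0F            = true
small 1F            = true
small (suc (suc _)) = false

module Construction (m r : ℕ) (r≤p : r ≤ 4 + m) where

  p q : ℕ
  p = 4 + m
  q = p + r

  twin : Fin r → Fin p
  twin j = inject≤ j r≤p

  ab : Fin 3 → Fin p → Bool
  ab 0F _ = true
  ab 1F b = small b
  ab 2F b = not (small b)

  ac : Fin 3 → Fin q → Bool
  ac 0F _ = false
  ac 1F c = [ not ∘ small , const true ]′ (splitAt p c)
  ac 2F c = [ small , const true ]′ (splitAt p c)

  bc : Fin p → Fin q → Bool
  bc b c = [ (λ i → not (does (b ≟ i))) , (λ j → does (b ≟ twin j)) ]′ (splitAt p c)

  open Tripartite ab ac bc

  A : Fin 3 → Vertex
  A a = 0F , a

  B : Fin p → Vertex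
  B b = 1F , b

  C : Fin p → Vertex
  C i = 2F , i ↑ˡ r

  D : Fin r → Vertex
  D j = 2F , p ↑ʳ j

  _⟶_ _⇝_ : Vertex → Vertex → Set
  _⟶_ = Arc
  u ⇝ v = Within Arc 2 u v

  C⟶B : ∀ i → C i ⟶ B i
  C⟶B i rewrite splitAt-↑ˡ p i r | dec-true (i ≟ i) refl = tt

  B⟶C : ∀ {b i} → b ≢ i → B b ⟶ C i
  B⟶C {b} {i} b≢i rewrite splitAt-↑ˡ p i r | dec-false (b ≟ i) b≢i = tt

  B⟶D : ∀ j → B (twin j) ⟶ D j
  B⟶D j rewrite splitAt-↑ʳ p r j | dec-true (twin j ≟ twin j) refl = tt

  D⟶B : ∀ {j b} → b ≢ twin j → D j ⟶ B b
  D⟶B {j} {b} b≢t rewrite splitAt-↑ʳ p r j | dec-false (b ≟ twin j) b≢t = tt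

  A₁⟶C : ∀ k → A 1F ⟶ C (suc (suc k))
  A₁⟶C k rewrite splitAt-↑ˡ p (suc (suc k)) r = tt

  C⟶A₂ : ∀ k → C (suc (suc k)) ⟶ A 2F
  C⟶A₂ k rewrite splitAt-↑ˡ p (suc (suc k)) r = tt

  A⟶D : ∀ a j → A (suc a) ⟶ D j
  A⟶D 0F j rewrite splitAt-↑ʳ p r j = tt
  A⟶D 1F j rewrite splitAt-↑ʳ p r j = tt

  stay : ∀ {u} → u ⇝ u
  stay = 0 , z≤n , nil

  direct : ∀ {u v} → u ⟶ v → u ⇝ v
  direct e = 1 , s≤s z≤n , cons e nil

  via : ∀ {u} w {v} → u ⟶ w → w ⟶ v → u ⇝ v
  via _ e f = 2 , ℕ.≤-refl , cons e (cons f nil)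

  B⇝-via-C : ∀ {x y v} → x ≢ y → C x ⟶ v → C y ⟶ v → ∀ b → B b ⇝ v
  B⇝-via-C {v = v} x≢y x⟶v y⟶v b with avoiding {P = λ k → C k ⟶ v} x≢y x⟶v y⟶v b
  ... | k , k⟶v , k≢b = via (C k) (B⟶C (≢-sym k≢b)) k⟶v

  ⇝C-via-B : ∀ {x y u} → x ≢ y → u ⟶ B x → u ⟶ B y → ∀ i → u ⇝ C i
  ⇝C-via-B {u = u} x≢y u⟶x u⟶y i with avoiding {P = λ k → u ⟶ B k} x≢y u⟶x u⟶y i
  ... | k , u⟶k , k≢i = via (B k) u⟶k (B⟶C k≢i)

  D⇝-via-B : ∀ {x y v} → x ≢ y → B x ⟶ v → B y ⟶ v → ∀ j → D j ⇝ v
  D⇝-via-B {v = v} x≢y x⟶v y⟶v j with avoiding {P = λ k → B k ⟶ v} x≢y x⟶v y⟶v (twin j)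
  ... | k , k⟶v , k≢t = via (B k) (D⟶B k≢t) k⟶v

  A⇝A : ∀ a a′ → A a ⇝ A a′
  A⇝A 0F 0F = stay
  A⇝A 1F 1F = stay
  A⇝A 2F 2F = stay
  A⇝A 0F 1F = via (B 2F) tt tt
  A⇝A 0F 2F = via (B 0F) tt tt
  A⇝A 1F 0F = via (C 2F) tt tt
  A⇝A 1F 2F = via (B 0F) tt tt
  A⇝A 2F 0F = via (C 0F) tt tt
  A⇝A 2F 1F = via (B 2F) tt tt

  A⇝B : ∀ a b → A a ⇝ B b
  A⇝B 0F _             = direct tt
  A⇝B 1F 0F            = direct tt
  A⇝B 1F 1F            = direct tt
  A⇝B 1F (suc (suc k)) = via (C (suc (suc k))) (A₁⟶C k) (C⟶B (suc (suc k)))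
  A⇝B 2F 0F            = via (C 0F) tt tt
  A⇝B 2F 1F            = via (C 1F) tt tt
  A⇝B 2F (suc (suc _)) = direct tt

  B⇝A : ∀ b a → B b ⇝ A a
  B⇝A b 0F = B⇝-via-C {0F} {1F} (λ ()) tt tt b
  B⇝A b 1F = B⇝-via-C {0F} {1F} (λ ()) tt tt b
  B⇝A b 2F = B⇝-via-C {2F} {3F} (λ ()) tt tt b

  A⇝C : ∀ a i → A a ⇝ C i
  A⇝C 0F = ⇝C-via-B {0F} {1F} (λ ()) tt tt
  A⇝C 1F = ⇝C-via-B {0F} {1F} (λ ()) tt tt
  A⇝C 2F = ⇝C-via-B {2F} {3F} (λ ()) tt tt

  C⇝A : ∀ i a → C i ⇝ A a
  C⇝A _             0F = direct tt
  C⇝A 0F            1F = direct tt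
  C⇝A 1F            1F = direct tt
  C⇝A (suc (suc k)) 1F = via (B (suc (suc k))) (C⟶B (suc (suc k))) tt
  C⇝A 0F            2F = via (B 0F) tt tt
  C⇝A 1F            2F = via (B 1F) tt tt
  C⇝A (suc (suc k)) 2F = direct (C⟶A₂ k)

  A⇝D : ∀ a j → A a ⇝ D j
  A⇝D 0F      j = via (B (twin j)) tt (B⟶D j)
  A⇝D (suc a) j = direct (A⟶D a j)

  D⇝A : ∀ j a → D j ⇝ A a
  D⇝A _ 0F = direct tt
  D⇝A j 1F = D⇝-via-B {2F} {3F} (λ ()) tt tt j
  D⇝A j 2F = D⇝-via-B {0F} {1F} (λ ()) tt tt j

  B⇝B : ∀ b b′ → B b ⇝ B b′
  B⇝B b b′ with b ≟ b′
  ... | yes refl = stay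
  ... | no b≢b′  = via (C b′) (B⟶C b≢b′) (C⟶B b′)

  B⇝C : ∀ b i → B b ⇝ C i
  B⇝C b i with b ≟ i
  ... | no b≢i   = direct (B⟶C b≢i)
  B⇝C 0F            _ | yes refl = via (A 2F) tt tt
  B⇝C 1F            _ | yes refl = via (A 2F) tt tt
  B⇝C (suc (suc k)) _ | yes refl = via (A 1F) tt (A₁⟶C k)

  C⇝B : ∀ i b → C i ⇝ B b
  C⇝B i b with i ≟ b
  ... | yes refl = direct (C⟶B i)
  ... | no _     = via (A 0F) tt tt

  B⇝D : ∀ b j → B b ⇝ D j
  B⇝D b j with b ≟ twin j
  ... | yes refl = direct (B⟶D j)
  B⇝D 0F            j | no _ = via (A 2F) tt (A⟶D 1F j)
  B⇝D 1F            j | no _ = via (A 2F) tt (A⟶D 1F j)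
  B⇝D (suc (suc _)) j | no _ = via (A 1F) tt (A⟶D 0F j)

  D⇝B : ∀ j b → D j ⇝ B b
  D⇝B j b with b ≟ twin j
  ... | yes refl = via (A 0F) tt tt
  ... | no b≢t   = direct (D⟶B b≢t)

  C⇝C : ∀ i i′ → C i ⇝ C i′
  C⇝C i i′ with i ≟ i′
  ... | yes refl = stay
  ... | no i≢i′  = via (B i) (C⟶B i) (B⟶C i≢i′)

  C⇝D : ∀ i j → C i ⇝ D j
  C⇝D 0F            j = via (A 1F) tt (A⟶D 0F j)
  C⇝D 1F            j = via (A 1F) tt (A⟶D 0F j)
  C⇝D (suc (suc k)) j = via (A 2F) (C⟶A₂ k) (A⟶D 1F j)

  D⇝C : ∀ j i → D j ⇝ C i
  D⇝C j i with avoiding₂ (twin j) i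
  ... | k , k≢t , k≢i = via (B k) (D⟶B k≢t) (B⟶C k≢i)

  D⇝D : ∀ j j′ → D j ⇝ D j′
  D⇝D j j′ with j ≟ j′
  ... | yes refl = stay
  ... | no j≢j′  =
    via (B (twin j′)) (D⟶B (j≢j′ ∘ sym ∘ inject≤-injective r≤p r≤p j′ j)) (B⟶D j′)

  data CorD : Fin q → Set where
    inC : ∀ i → CorD (i ↑ˡ r)
    inD : ∀ j → CorD (p ↑ʳ j)

  corD : ∀ c → CorD c
  corD c with splitAt p c in eq
  ... | inj₁ i = subst CorD (splitAt⁻¹-↑ˡ eq) (inC i)
  ... | inj₂ j = subst CorD (splitAt⁻¹-↑ʳ eq) (inD j)

  ⇝-all : ∀ u v → u ⇝ v
  ⇝-all (0F , a) (0F , a′) = A⇝A a a′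
  ⇝-all (0F , a) (1F , b)  = A⇝B a b
  ⇝-all (1F , b) (0F , a)  = B⇝A b a
  ⇝-all (1F , b) (1F , b′) = B⇝B b b′
  ⇝-all (0F , a) (2F , c) with corD c
  ... | inC i = A⇝C a i
  ... | inD j = A⇝D a j
  ⇝-all (1F , b) (2F , c) with corD c
  ... | inC i = B⇝C b i
  ... | inD j = B⇝D b j
  ⇝-all (2F , c) (0F , a) with corD c
  ... | inC i = C⇝A i a
  ... | inD j = D⇝A j a
  ⇝-all (2F , c) (1F , b) with corD c
  ... | inC i = C⇝B i b
  ... | inD j = D⇝B j b
  ⇝-all (2F , c) (2F , c′) with corD c | corD c′
  ... | inC i | inC i′ = C⇝C i i′
  ... | inC i | inD j  = C⇝D i j
  ... | inD j | inC i  = D⇝C j i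
  ... | inD j | inD j′ = D⇝D j j′

  orientedDiameter : OrientedDiameter (K3 3 p q) 2
  orientedDiameter =
    orientedDiameter≡2 {u = A 0F} {A 1F} (λ ()) (λ ne → ne refl) isOrientation ⇝-all

K3-3-p-q-orientedDiameter≡2 : ∀ p q → 4 ≤ p → p ≤ q → q ≤ 2 * p →
                              OrientedDiameter (K3 3 p q) 2
K3-3-p-q-orientedDiameter≡2 p@(suc (suc (suc (suc m)))) q (s≤s (s≤s (s≤s (s≤s _)))) p≤q q≤2p
  with ℕ.m≤n⇒∃[o]m+o≡n p≤q
... | r , refl = Construction.orientedDiameter m r r≤p
  where
  r≤p : r ≤ p
  r≤p = subst (r ≤_) (ℕ.+-identityʳ p) (ℕ.+-cancelˡ-≤ p r (p + 0) q≤2p)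

theorem5p9 : ∀ (p q : ℕ) → 5 ≤ p → p ≤ q → q ≤ 2 * p →
    OrientedDiameter (K3 3 p q) 2
theorem5p9 p q 5≤p = K3-3-p-q-orientedDiameter≡2 p q (ℕ.≤-trans (ℕ.n≤1+n 4) 5≤p)
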